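{- (Provably in $\mathrm{EA}$.) Let $A,B$ be worms over $\omega\cdot2$ and $x\le y$ natural numbers. If $h_A(y)$ is defined and $B\trianglelefteq_y A$, then $h_B(x)$ is defined and $h_B(x)\le h_A(y)$.
   Context: Worms over $\omega\cdot2$: finite possibly empty sequences of ordinals $<\omega\cdot2$, empty worm $\top$, concatenation $AB$, $C^k$ $k$-fold concatenation. $h_\alpha(\top)=\top$, $h_\alpha(\beta A)=\top$ if $\beta<\alpha$, else $\beta h_\alpha(A)$; $r_\alpha(\top)=\top$, $r_\alpha(\beta A)=\beta A$ if $\beta<\alpha$, else $r_\alpha(A)$. Step-down: $\top\llbracket k\rrbracket=\top$, $(0B)\llbracket k\rrbracket=B$, $((\alpha+1)B)\llbracket k\rrbracket=(\alpha\,h_{\alpha+1}(B))^{k+1}r_{\alpha+1}(B)$, $(\omega B)\llbracket k\rrbracket=kB$. $h_A(m)$ is the least $k$ with $A\llbracket m\rrbracket\llbracket m+1\rrbracket\cdots\llbracket m+k\rrbracket=\top$ (undefined if none). Order: $B\trianglelefteq A$ iff $B=\top$ or there are worms $C,D$ and ordinals $\beta\le\alpha$ with $A=D\alpha C$ and $B=\beta C$. $B\trianglelefteq_m A$ iff $B\trianglelefteq A$ and, in case $B=nC$ with $n<\omega$ and $A=D\alpha C$ with $\alpha\ge\omega$, also $n\le m$. -}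

module Defs where

open import Data.Nat using (ℕ; zero; suc; _+_; _≤_; _<_)
open import Data.Nat.Properties using (_<?_)
open import Data.Bool using (Bool; true; false; if_then_else_)
open import Data.List using (List; []; _∷_; _++_)
open import Data.Product using (Σ; ∃; _×_; _,_)
open import Data.Sum using (_⊎_)
open import Data.Unit using () renaming (⊤ to Unit)
open import Relation.Nullary using (¬_)
open import Relation.Nullary.Decidable using (⌊_⌋)
open import Relation.Binary.PropositionalEquality using (_≡_)

-- Ordinals below ω·2:  fin n = n,  om n = ω + n.
data Ord : Set where
  fin : ℕ → Ord
  om  : ℕ → Ord

data _<ᵒ_ : Ord → Ord → Set where
  fin<fin : ∀ {m n} → m < n → fin m <ᵒ fin n
  fin<om  : ∀ {m n} → fin m <ᵒ om n
  om<om   : ∀ {m n} → m < n → om m <ᵒ om n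

data _≤ᵒ_ : Ord → Ord → Set where
  fin≤fin : ∀ {m n} → m ≤ n → fin m ≤ᵒ fin n
  fin≤om  : ∀ {m n} → fin m ≤ᵒ om n
  om≤om   : ∀ {m n} → m ≤ n → om m ≤ᵒ om n

ltᵒ : Ord → Ord → Bool
ltᵒ (fin m) (fin n) = ⌊ m <? n ⌋
ltᵒ (fin m) (om n)  = true
ltᵒ (om m)  (fin n) = false
ltᵒ (om m)  (om n)  = ⌊ m <? n ⌋

-- Worms: finite sequences of ordinals < ω·2; the empty worm ⊤ is [].
Worm : Set
Worm = List Ord

hw : Ord → Worm → Worm
hw α []      = []
hw α (β ∷ A) = if ltᵒ β α then [] else β ∷ hw α A

rw : Ord → Worm → Worm
rw α []      = []
rw α (β ∷ A) = if ltᵒ β α then β ∷ A else rw α A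

pow : Worm → ℕ → Worm
pow C zero    = []
pow C (suc k) = C ++ pow C k

step : Worm → ℕ → Worm
step []               k = []
step (fin zero ∷ B)    k = B
step (fin (suc a) ∷ B) k = pow (fin a ∷ hw (fin (suc a)) B) (suc k) ++ rw (fin (suc a)) B
step (om zero ∷ B)     k = fin k ∷ B
step (om (suc a) ∷ B)  k = pow (om a ∷ hw (om (suc a)) B) (suc k) ++ rw (om (suc a)) B

steps : Worm → ℕ → ℕ → Worm
steps A m zero    = step A m
steps A m (suc k) = step (steps A m k) (m + suc k)

-- IsH A m k :  h_A(m) is defined and equals k
IsH : Worm → ℕ → ℕ → Set
IsH A m k = (steps A m k ≡ []) × (∀ j → j < k → ¬ (steps A m j ≡ []))

_⊴_ : Worm → Worm → Set
B ⊴ A = (B ≡ []) ⊎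
  Σ Worm λ C → Σ Worm λ D → Σ Ord λ β → Σ Ord λ α →
    (β ≤ᵒ α) × (A ≡ D ++ (α ∷ C)) × (B ≡ β ∷ C)

Cond : ℕ → Ord → Ord → Set
Cond m (fin n) (om _) = n ≤ m
Cond m _ _ = Unit

_⊴[_]_ : Worm → ℕ → Worm → Set
B ⊴[ m ] A = (B ≡ []) ⊎
  Σ Worm λ C → Σ Worm λ D → Σ Ord λ β → Σ Ord λ α →
    (β ≤ᵒ α) × (A ≡ D ++ (α ∷ C)) × (B ≡ β ∷ C) × Cond m β α

{-# OPTIONS --safe #-}
-- One step-down preserves the order: if B ⊴_y A then either B = A, or
-- B ⊴_{y+1} A⟦y⟧, because the head of A is either dropped or replaced by copies
-- of a smaller head that still dominates the head of B, while h_σ(C) r_σ(C) = C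
-- keeps the common tail C as a suffix. When B = A, instead B⟦x⟧ ⊴_{y+1} A⟦y⟧
-- for x ≤ y. So by induction along the step-down sequence of A, the sequence of
-- B (started at x) reaches ⊤ no later than that of A (started at y).
module Submission where

open import Defs
open import Data.Nat using (ℕ; zero; suc; _≤_; _<_; z≤n; s≤s; _≤′_; ≤′-refl; ≤′-step)
open import Data.Nat.Properties
  using (≤-refl; ≤-trans; n≤1+n; m≤n⇒m≤1+n; +-comm; +-suc; m≤n⇒m<n∨m≡n; ≤⇒≤′)
open import Data.List using ([]; _∷_; _++_)
open import Data.List.Properties using (++-assoc; ++-identityʳ)
open import Data.Product using (Σ; _×_; _,_; ∃)
open import Data.Sum using (_⊎_; inj₁; inj₂)
open import Data.Bool using (true; false)
open import Data.Unit using (tt)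
open import Relation.Nullary using (¬_)
open import Relation.Binary.PropositionalEquality
  using (_≡_; refl; sym; trans; cong; cong₂; subst; module ≡-Reasoning)

≤ᵒ-refl : ∀ α → α ≤ᵒ α
≤ᵒ-refl (fin n) = fin≤fin ≤-refl
≤ᵒ-refl (om n)  = om≤om ≤-refl

≤ᵒ⇒≡⊎<ᵒ : ∀ {β α} → β ≤ᵒ α → β ≡ α ⊎ β <ᵒ α
≤ᵒ⇒≡⊎<ᵒ (fin≤fin b≤a) with m≤n⇒m<n∨m≡n b≤a
... | inj₁ b<a = inj₂ (fin<fin b<a)
... | inj₂ refl = inj₁ refl
≤ᵒ⇒≡⊎<ᵒ fin≤om = inj₂ fin<om
≤ᵒ⇒≡⊎<ᵒ (om≤om b≤a) with m≤n⇒m<n∨m≡n b≤a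
... | inj₁ b<a = inj₂ (om<om b<a)
... | inj₂ refl = inj₁ refl

Cond-refl : ∀ m α → Cond m α α
Cond-refl m (fin n) = tt
Cond-refl m (om n)  = tt

Cond-mono : ∀ {m m′} → m ≤ m′ → ∀ β α → Cond m β α → Cond m′ β α
Cond-mono m≤m′ (fin n) (fin k) c = tt
Cond-mono m≤m′ (fin n) (om k)  c = ≤-trans c m≤m′
Cond-mono m≤m′ (om n)  (fin k) c = tt
Cond-mono m≤m′ (om n)  (om k)  c = tt

hw++rw : ∀ σ C → hw σ C ++ rw σ C ≡ C
hw++rw σ [] = refl
hw++rw σ (β ∷ C) with ltᵒ β σ
... | true  = refl
... | false = cong (β ∷_) (hw++rw σ C)

pow-suc-++ : ∀ W k → pow W (suc k) ≡ pow W k ++ W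
pow-suc-++ W zero    = ++-identityʳ W
pow-suc-++ W (suc k) = trans (cong (W ++_) (pow-suc-++ W k)) (sym (++-assoc W (pow W k) W))

pow-hw-++-rw : ∀ π σ C k →
  pow (π ∷ hw σ C) (suc k) ++ rw σ C ≡ pow (π ∷ hw σ C) k ++ π ∷ C
pow-hw-++-rw π σ C k = begin
  pow W (suc k) ++ rw σ C            ≡⟨ cong (_++ rw σ C) (pow-suc-++ W k) ⟩
  (pow W k ++ W) ++ rw σ C           ≡⟨ ++-assoc (pow W k) W (rw σ C) ⟩
  pow W k ++ π ∷ (hw σ C ++ rw σ C)  ≡⟨ cong (λ D → pow W k ++ π ∷ D) (hw++rw σ C) ⟩
  pow W k ++ π ∷ C                   ∎
  where
  open ≡-Reasoning
  W = π ∷ hw σ C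

⊴-[] : ∀ {B m} → B ⊴[ m ] [] → B ≡ []
⊴-[] (inj₁ B≡[]) = B≡[]
⊴-[] (inj₂ (_ , [] , _ , _ , _ , () , _))
⊴-[] (inj₂ (_ , _ ∷ _ , _ , _ , _ , () , _))

⊴-refl : ∀ A m → A ⊴[ m ] A
⊴-refl []      m = inj₁ refl
⊴-refl (α ∷ C) m = inj₂ (C , [] , α , α , ≤ᵒ-refl α , refl , refl , Cond-refl m α)

⊴-++ˡ : ∀ {B A m} D → B ⊴[ m ] A → B ⊴[ m ] (D ++ A)
⊴-++ˡ D (inj₁ B≡[]) = inj₁ B≡[]
⊴-++ˡ D (inj₂ (C , E , β , α , β≤α , refl , B≡βC , c)) =
  inj₂ (C , D ++ E , β , α , β≤α , sym (++-assoc D E (α ∷ C)) , B≡βC , c)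

⊴-successor-step : ∀ {B m} π σ C k → B ⊴[ m ] (π ∷ C) →
  B ⊴[ m ] (pow (π ∷ hw σ C) (suc k) ++ rw σ C)
⊴-successor-step {B} {m} π σ C k rel =
  subst (B ⊴[ m ]_) (sym (pow-hw-++-rw π σ C k)) (⊴-++ˡ (pow (π ∷ hw σ C) k) rel)

⊴-pow-++ : ∀ W r m {x y} → x ≤′ y → (pow W x ++ r) ⊴[ m ] (pow W y ++ r)
⊴-pow-++ W r m ≤′-refl = ⊴-refl _ m
⊴-pow-++ W r m (≤′-step {y} x≤′y) =
  subst (_ ⊴[ m ]_) (sym (++-assoc W (pow W y) r)) (⊴-++ˡ W (⊴-pow-++ W r m x≤′y))

step-mono : ∀ A m {x y} → x ≤ y → step A x ⊴[ m ] step A y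
step-mono []                m x≤y = inj₁ refl
step-mono (fin zero ∷ C)    m x≤y = ⊴-refl C m
step-mono (fin (suc a) ∷ C) m x≤y =
  ⊴-pow-++ (fin a ∷ hw (fin (suc a)) C) (rw (fin (suc a)) C) m (≤⇒≤′ (s≤s x≤y))
step-mono (om zero ∷ C)     m {x} {y} x≤y =
  inj₂ (C , [] , fin x , fin y , fin≤fin x≤y , refl , refl , tt)
step-mono (om (suc a) ∷ C)  m x≤y =
  ⊴-pow-++ (om a ∷ hw (om (suc a)) C) (rw (om (suc a)) C) m (≤⇒≤′ (s≤s x≤y))

⊴-tail-step : ∀ {B E m} d y → B ⊴[ m ] E → B ⊴[ m ] step (d ∷ E) y
⊴-tail-step (fin zero)    y rel = rel
⊴-tail-step {E = E} (fin (suc a)) y rel =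
  ⊴-successor-step (fin a) (fin (suc a)) E y (⊴-++ˡ (fin a ∷ []) rel)
⊴-tail-step (om zero)     y rel = ⊴-++ˡ (fin y ∷ []) rel
⊴-tail-step {E = E} (om (suc a))  y rel =
  ⊴-successor-step (om a) (om (suc a)) E y (⊴-++ˡ (om a ∷ []) rel)

<ᵒ-head-step : ∀ {β α} C y → β <ᵒ α → Cond y β α →
  (β ∷ C) ⊴[ suc y ] step (α ∷ C) y
<ᵒ-head-step C y (fin<fin {b} {suc a} (s≤s b≤a)) c =
  ⊴-successor-step (fin a) (fin (suc a)) C y
    (inj₂ (C , [] , fin b , fin a , fin≤fin b≤a , refl , refl , tt))
<ᵒ-head-step C y (fin<om {b} {zero}) b≤y =
  inj₂ (C , [] , fin b , fin y , fin≤fin b≤y , refl , refl , tt)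
<ᵒ-head-step C y (fin<om {b} {suc a}) b≤y =
  ⊴-successor-step (om a) (om (suc a)) C y
    (inj₂ (C , [] , fin b , om a , fin≤om , refl , refl , m≤n⇒m≤1+n b≤y))
<ᵒ-head-step C y (om<om {b} {suc a} (s≤s b≤a)) c =
  ⊴-successor-step (om a) (om (suc a)) C y
    (inj₂ (C , [] , om b , om a , om≤om b≤a , refl , refl , tt))

⊴-step : ∀ {B A y} → B ⊴[ y ] A → B ≡ A ⊎ B ⊴[ suc y ] step A y
⊴-step (inj₁ B≡[]) = inj₂ (inj₁ B≡[])
⊴-step {y = y} (inj₂ (C , [] , β , α , β≤α , refl , refl , c)) with ≤ᵒ⇒≡⊎<ᵒ β≤α
... | inj₁ refl = inj₁ refl
... | inj₂ β<α  = inj₂ (<ᵒ-head-step C y β<α c)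
⊴-step {y = y} (inj₂ (C , d ∷ D , β , α , β≤α , refl , refl , c)) =
  inj₂ (⊴-tail-step d y
    (inj₂ (C , D , β , α , β≤α , refl , refl , Cond-mono (n≤1+n y) β α c)))

-- Halts A m n: the sequence A⟦m⟧⟦m+1⟧⋯ reaches ⊤ after exactly n step-downs,
-- so h_A(m) = n − 1 for A ≠ ⊤.
data Halts : Worm → ℕ → ℕ → Set where
  halted   : ∀ {m} → Halts [] m 0
  continue : ∀ {α A m n} → Halts (step (α ∷ A) m) (suc m) n → Halts (α ∷ A) m (suc n)

Halts-zero⇒[] : ∀ {A m} → Halts A m 0 → A ≡ []
Halts-zero⇒[] halted = refl

Halts-suc⇒≢[] : ∀ {A m n} → Halts A m (suc n) → ¬ A ≡ []
Halts-suc⇒≢[] (continue _) ()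

steps-suc : ∀ A m k → steps A m (suc k) ≡ steps (step A m) (suc m) k
steps-suc A m zero    = cong (step (step A m)) (+-comm m 1)
steps-suc A m (suc k) = cong₂ step (steps-suc A m k) (+-suc m (suc k))

steps≡[]⇒Halts : ∀ A m k → steps A m k ≡ [] → ∃ λ n → Halts A m n × n ≤ suc k
steps≡[]⇒Halts []      m k       eq = 0 , halted , z≤n
steps≡[]⇒Halts (α ∷ A) m zero    eq =
  1 , continue (subst (λ W → Halts W (suc m) 0) (sym eq) halted) , ≤-refl
steps≡[]⇒Halts (α ∷ A) m (suc k) eq
  with steps≡[]⇒Halts (step (α ∷ A) m) (suc m) k (trans (sym (steps-suc (α ∷ A) m k)) eq)
... | n , h , n≤ = suc n , continue h , s≤s n≤

Halts-suc⇒IsH : ∀ {A m k} → Halts A m (suc k) → IsH A m k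
Halts-suc⇒IsH {k = zero} (continue h) = Halts-zero⇒[] h , λ j ()
Halts-suc⇒IsH {α ∷ A} {m} {suc k} (continue h) with Halts-suc⇒IsH h
... | reaches , minimal = trans (steps-suc (α ∷ A) m k) reaches , earlier≢[]
  where
  earlier≢[] : ∀ j → j < suc k → ¬ steps (α ∷ A) m j ≡ []
  earlier≢[] zero    _         = Halts-suc⇒≢[] h
  earlier≢[] (suc j) (s≤s j<k) eq = minimal j j<k (trans (sym (steps-suc (α ∷ A) m j)) eq)

Halts⇒IsH : ∀ {A m n k} → Halts A m n → n ≤ suc k →
  ∃ λ k′ → IsH A m k′ × k′ ≤ k
Halts⇒IsH halted       _          = 0 , (refl , λ j ()) , z≤n
Halts⇒IsH (continue h) (s≤s n≤k) = _ , Halts-suc⇒IsH (continue h) , n≤k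

Halts-⊴ : ∀ {A B x y n} → Halts A y n → x ≤ y → B ⊴[ y ] A →
  ∃ λ n′ → Halts B x n′ × n′ ≤ n
Halts-⊴ halted _ rel with ⊴-[] rel
... | refl = 0 , halted , z≤n
Halts-⊴ {A} {y = y} (continue h) x≤y rel with ⊴-step rel
... | inj₁ refl with Halts-⊴ h (s≤s x≤y) (step-mono A (suc y) x≤y)
...   | n′ , h′ , n′≤ = suc n′ , continue h′ , s≤s n′≤
Halts-⊴ (continue h) x≤y rel | inj₂ rel′ with Halts-⊴ h (m≤n⇒m≤1+n x≤y) rel′
...   | n′ , h′ , n′≤ = n′ , h′ , m≤n⇒m≤1+n n′≤

lemma16 : (A B : Worm) (x y : ℕ) → x ≤ y → (k : ℕ) → IsH A y k → B ⊴[ y ] A →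
    Σ ℕ λ k′ → IsH B x k′ × k′ ≤ k
lemma16 A B x y x≤y k (reaches , _) rel with steps≡[]⇒Halts A y k reaches
... | n , hA , n≤ with Halts-⊴ hA x≤y rel
... | n′ , hB , n′≤n = Halts⇒IsH hB (≤-trans n′≤n n≤)
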